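{- Suppose that for every positive integer $s$ and every integer $r$, there is at least one nonnegative integer $N\equiv r\pmod{3^s}$ such that $p(N)\not\equiv 0\pmod 3$. Then for every positive integer $s$ and every integer $r$, there are infinitely many nonnegative integers $N\equiv r\pmod{3^s}$ such that $p(N)\not\equiv0\pmod 3$.
   Context: $p(n)$ denotes the partition function, the number of partitions of the nonnegative integer $n$. -}

module Defs where

open import Data.Nat using (ℕ; zero; suc; _+_; _∸_; _⊓_)
open import Data.List using (List; []; _∷_; map; applyUpTo)
open import Data.Nat.ListAction using (sum)

-- countParts f n k : number of partitions of n into positive parts each ≤ k,
-- computed with fuel f (exact whenever f ≥ n, since every step removes a part ≥ 1).
-- Choosing the largest part j ∈ {1..min(n,k)}, the rest is a partition of n ∸ j
-- with parts ≤ j.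
countParts : ℕ → ℕ → ℕ → ℕ
countParts _       zero    _ = 1
countParts zero    (suc _) _ = 0
countParts (suc f) (suc n) k =
  sum (applyUpTo (λ i → countParts f (suc n ∸ suc i) (suc i)) (suc n ⊓ k))

p : ℕ → ℕ
p n = countParts n n n

{-# OPTIONS --safe #-}
-- Given s, r and a bound M, pick a ≡ r (mod 3^(s+1)) with M ≤ a < (M+1)·3^(s+1) ≤ 3^(s+M+1).
-- The hypothesis at level s+M yields N ≥ 0 with N ≡ a (mod 3^(s+M+1)) and 3 ∤ p(N).
-- As 0 ≤ a < 3^(s+M+1), a is the least nonnegative element of its residue class, so
-- N ≥ a ≥ M, and N ≡ a ≡ r (mod 3^(s+1)).
module Submission where

open import Defs
open import Data.Nat using (ℕ; suc; _^_; _≥_)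
open import Data.Nat.Divisibility using (_∣_)
open import Data.Integer using (ℤ; +_; _-_)
open import Data.Integer.Divisibility using () renaming (_∣_ to _∣ℤ_)
open import Data.Product using (Σ; _×_)
open import Relation.Nullary using (¬_)

open import Data.Nat using (zero; z≤n; s≤s; _+_; _*_; _∸_; _≤_; _<_; _≤?_; NonZero; z<s; >-nonZero)
open import Data.Nat.Properties
  using (≤-trans; <-≤-trans; ≤-<-trans; <-irrefl; *-comm; *-monoˡ-≤; +-monoˡ-<; m≤m*n; m≤n+m; m<m*n;
         m∸n≤m; m<n⇒0<n∸m; ≰⇒>; ^-distribˡ-+-*; m^n≢0; module ≤-Reasoning)
open import Data.Nat.Divisibility using (∣-trans; ∣⇒≤; m∣m*n)
import Data.Integer as ℤ
open import Data.Integer.Properties using ([+m]-[+n]≡m⊖n; ∣⊖∣-<; pos-+; pos-*)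
open import Data.Integer.DivMod using (_%ℕ_; _/ℕ_; n%ℕd<d; a≡a%ℕn+[a/ℕn]*n)
import Data.Integer.Divisibility.Signed as Signed
open import Data.Integer.Tactic.RingSolver using (solve-∀)
open import Data.Product using (_,_)
open import Relation.Nullary using (yes; no; contradiction)
open import Relation.Binary.PropositionalEquality using (_≡_; refl; sym; trans; cong; cong₂; subst; module ≡-Reasoning)

n<m^n : ∀ m n → 1 < m → n < m ^ n
n<m^n m zero    1<m = z<s
n<m^n m@(suc _) (suc n) 1<m = ≤-<-trans (n<m^n m n 1<m) m^n<m*m^n
  where
  instance
    m^n≢0′ : NonZero (m ^ n)
    m^n≢0′ = m^n≢0 m n
  m^n<m*m^n : m ^ n < m * m ^ n
  m^n<m*m^n = subst (m ^ n <_) (*-comm (m ^ n) m) (m<m*n (m ^ n) m 1<m)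

≡-mod-trans : ∀ {k x y z} → k ∣ℤ (x - y) → k ∣ℤ (y - z) → k ∣ℤ (x - z)
≡-mod-trans {k} {x} {y} {z} k∣x-y k∣y-z =
  Signed.∣⇒∣ᵤ (subst (k Signed.∣_) (telescope x y z)
    (Signed.∣m∣n⇒∣m+n (Signed.∣ᵤ⇒∣ {k} {x - y} k∣x-y) (Signed.∣ᵤ⇒∣ {k} {y - z} k∣y-z)))
  where
  telescope : ∀ x y z → (x - y) ℤ.+ (y - z) ≡ x - z
  telescope = solve-∀

≡-mod-<⇒≤ : ∀ {K a n} → + K ∣ℤ (+ n - + a) → a < K → a ≤ n
≡-mod-<⇒≤ {K} {a} {n} K∣n-a a<K with a ≤? n
... | yes a≤n = a≤n
... | no a≰n = contradiction (<-≤-trans a<K (≤-trans K≤a∸n (m∸n≤m a n))) (<-irrefl refl)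
  where
  n<a : n < a
  n<a = ≰⇒> a≰n
  K∣a∸n : K ∣ a ∸ n
  K∣a∸n = subst (K ∣_) (trans (cong ℤ.∣_∣ ([+m]-[+n]≡m⊖n n a)) (∣⊖∣-< n<a)) K∣n-a
  K≤a∸n : K ≤ a ∸ n
  K≤a∸n = ∣⇒≤ ⦃ >-nonZero (m<n⇒0<n∸m n<a) ⦄ K∣a∸n

≡-mod-representative : ∀ m .⦃ _ : NonZero m ⦄ (r : ℤ) (M : ℕ) →
  Σ ℕ λ a → M ≤ a × a < suc M * m × + m ∣ℤ (+ a - r)
≡-mod-representative m r M = a , M≤a , a<[1+M]*m , Signed.∣⇒∣ᵤ m∣a-r
  where
  q : ℕ
  q = r %ℕ m
  d : ℤ
  d = r /ℕ m
  a : ℕ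
  a = q + M * m
  M≤a : M ≤ a
  M≤a = ≤-trans (m≤m*n M m) (m≤n+m (M * m) q)
  a<[1+M]*m : a < suc M * m
  a<[1+M]*m = +-monoˡ-< (M * m) (n%ℕd<d r m)
  shift : ∀ q M d m → (q ℤ.+ M ℤ.* m) - (q ℤ.+ d ℤ.* m) ≡ (M - d) ℤ.* m
  shift = solve-∀
  a-r≡[M-d]*m : + a - r ≡ (+ M - d) ℤ.* + m
  a-r≡[M-d]*m = begin
    + (q + M * m) - r                          ≡⟨ cong₂ _-_ (trans (pos-+ q (M * m)) (cong (ℤ._+_ (+ q)) (pos-* M m)))
                                                            (a≡a%ℕn+[a/ℕn]*n r m) ⟩
    (+ q ℤ.+ + M ℤ.* + m) - (+ q ℤ.+ d ℤ.* + m) ≡⟨ shift (+ q) (+ M) d (+ m) ⟩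
    (+ M - d) ℤ.* + m                          ∎
    where open ≡-Reasoning
  m∣a-r : + m Signed.∣ (+ a - r)
  m∣a-r = subst (+ m Signed.∣_) (sym a-r≡[M-d]*m) (Signed.∣n⇒∣m*n (+ M - d) Signed.∣-refl)

lemma3p1 : (∀ (s : ℕ) (r : ℤ) → Σ ℕ λ N → (+ (3 ^ suc s) ∣ℤ ((+ N) - r)) × ¬ (3 ∣ p N))
    → ∀ (s : ℕ) (r : ℤ) (M : ℕ) → Σ ℕ λ N → N ≥ M × (+ (3 ^ suc s) ∣ℤ ((+ N) - r)) × ¬ (3 ∣ p N)
lemma3p1 H s r M =
  let a , M≤a , a<[1+M]*m , m∣a-r = ≡-mod-representative m r M
      N , K∣N-a , 3∤pN = H (s + M) (+ a)
  in  N
    , ≤-trans M≤a (≡-mod-<⇒≤ K∣N-a (a<K a<[1+M]*m))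
    , ≡-mod-trans {+ m} {+ N} {+ a} {r} (∣-trans m∣K K∣N-a) m∣a-r
    , 3∤pN
  where
  m : ℕ
  m = 3 ^ suc s
  instance
    m≢0 : NonZero m
    m≢0 = m^n≢0 3 (suc s)
  K : ℕ
  K = 3 ^ suc (s + M)
  K≡m*3^M : K ≡ m * 3 ^ M
  K≡m*3^M = ^-distribˡ-+-* 3 (suc s) M
  m∣K : m ∣ K
  m∣K = subst (m ∣_) (sym K≡m*3^M) (m∣m*n (3 ^ M))
  a<K : ∀ {a} → a < suc M * m → a < K
  a<K {a} a<[1+M]*m = begin-strict
    a             <⟨ a<[1+M]*m ⟩
    suc M * m     ≤⟨ *-monoˡ-≤ m (n<m^n 3 M (s≤s (s≤s z≤n))) ⟩
    3 ^ M * m     ≡⟨ trans (*-comm (3 ^ M) m) (sym K≡m*3^M) ⟩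
    K             ∎
    where open ≤-Reasoning
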